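{- Let $S=X_1\times\cdots\times X_n$ be a product state space, $A$ an action set, and $F:S\to\mathcal P(A)$ arbitrary (possibly with empty values). Let $A^+=A\sqcup\{\mathtt{none}\}$ and define $G:S\to\mathcal P(A^+)$ by $G(s)=F(s)$ (viewed inside $A^+$) if $F(s)\neq\varnothing$ and $G(s)=\{\mathtt{none}\}$ if $F(s)=\varnothing$. Fix reals $u_{\mathrm{blocked}}<u_{\mathrm{allowed}}$ and let $D$ be the decision problem on $S$ with action set $A^+$ and utility $U(a,s)=u_{\mathrm{allowed}}$ if $a\in G(s)$, $U(a,s)=u_{\mathrm{blocked}}$ otherwise. Then a set $I\subseteq\{1,\dots,n\}$ is sufficient for $F$ if and only if it is sufficient for $D$, and a coordinate $i$ is relevant for $F$ if and only if it is relevant for $D$.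
   Context: For a decision problem with action set $A$ and utility $U:A\times S\to\mathbb R$, $\mathrm{Opt}(s)=\{a\in A:\ U(a',s)\le U(a,s)\ \forall a'\in A\}$; $I$ is sufficient for it if $s_j=s'_j$ for all $j\in I$ implies $\mathrm{Opt}(s)=\mathrm{Opt}(s')$, and $i$ is relevant for it if there are $s,s'$ agreeing on all coordinates $j\neq i$ with $\mathrm{Opt}(s)\neq\mathrm{Opt}(s')$. For a set-valued map $F$, $I$ is sufficient for $F$ if $s_j=s'_j$ for all $j\in I$ implies $F(s)=F(s')$, and $i$ is relevant for $F$ if there are $s,s'$ agreeing on all coordinates $j\neq i$ with $F(s)\neq F(s')$. -}

module Defs where

open import Level using (Level; 0ℓ)
open import Data.Nat using (ℕ)
open import Data.Fin using (Fin)
open import Data.Fin.Subset using (Subset; _∈_)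
open import Data.Maybe using (Maybe; just; nothing)
open import Data.Product using (Σ; ∃; _×_; _,_)
open import Data.Bool using (if_then_else_)
open import Relation.Nullary using (¬_)
open import Relation.Nullary.Decidable using (⌊_⌋)
open import Relation.Binary.PropositionalEquality using (_≡_; _≢_)
open import Relation.Binary.Bundles using (TotalOrder)
open import Axiom.ExcludedMiddle using (ExcludedMiddle)
import Relation.Binary.Construct.NonStrictToStrict as NSS

State : {n : ℕ} → (Fin n → Set) → Set
State {n} X = (i : Fin n) → X i

-- Subsets of a type are predicates; P(A) = A → Set.
-- Equality of subsets is extensional.
SetEq : {A : Set} → (A → Set) → (A → Set) → Set
SetEq {A} P Q = (a : A) → (P a → Q a) × (Q a → P a)

AgreeOn : {n : ℕ} {X : Fin n → Set} → Subset n → State X → State X → Set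
AgreeOn {n} I s s' = (j : Fin n) → j ∈ I → s j ≡ s' j

AgreeExcept : {n : ℕ} {X : Fin n → Set} → Fin n → State X → State X → Set
AgreeExcept {n} i s s' = (j : Fin n) → j ≢ i → s j ≡ s' j

SufficientMap : {n : ℕ} {X : Fin n → Set} {A : Set} →
                (State X → A → Set) → Subset n → Set
SufficientMap F I = ∀ s s' → AgreeOn I s s' → SetEq (F s) (F s')

RelevantMap : {n : ℕ} {X : Fin n → Set} {A : Set} →
              (State X → A → Set) → Fin n → Set
RelevantMap {X = X} F i =
  Σ (State X) λ s → Σ (State X) λ s' → AgreeExcept i s s' × ¬ SetEq (F s) (F s')

-- Decision problems with utilities in a total order (stand-in for ℝ)
module _ {c ℓ₁ ℓ₂} (O : TotalOrder c ℓ₁ ℓ₂) where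
  open TotalOrder O

  _<ᵤ_ : Carrier → Carrier → Set _
  _<ᵤ_ = NSS._<_ _≈_ _≤_

  Opt : {n : ℕ} {X : Fin n → Set} {A : Set} →
        (A → State X → Carrier) → State X → A → Set ℓ₂
  Opt {A = A} U s a = (a' : A) → U a' s ≤ U a s

  SufficientD : {n : ℕ} {X : Fin n → Set} {A : Set} →
                (A → State X → Carrier) → Subset n → Set ℓ₂
  SufficientD U I = ∀ s s' → AgreeOn I s s' → (∀ a → (Opt U s a → Opt U s' a) × (Opt U s' a → Opt U s a))

  RelevantD : {n : ℕ} {X : Fin n → Set} {A : Set} →
              (A → State X → Carrier) → Fin n → Set ℓ₂
  RelevantD {X = X} U i =
    Σ (State X) λ s → Σ (State X) λ s' → AgreeExcept i s s' ×
      ¬ (∀ a → (Opt U s a → Opt U s' a) × (Opt U s' a → Opt U s a))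

APlus : Set → Set
APlus A = Maybe A

-- G(s) = F(s) (inside A⁺) if F(s) ≠ ∅, and {none} if F(s) = ∅.
-- Membership: just a ∈ G(s) iff a ∈ F(s);  none ∈ G(s) iff F(s) = ∅.
G : {n : ℕ} {X : Fin n → Set} {A : Set} →
    (State X → A → Set) → State X → APlus A → Set
G F s (just a) = F s a
G {A = A} F s nothing = (a : A) → ¬ F s a

-- U(a,s) = u_allowed if a ∈ G(s), u_blocked otherwise
-- (the case split uses excluded middle, as in classical mathematics).
UD : ∀ {c ℓ₁ ℓ₂} (O : TotalOrder c ℓ₁ ℓ₂) → ExcludedMiddle 0ℓ →
     {n : ℕ} {X : Fin n → Set} {A : Set} →
     (State X → A → Set) →
     (ublocked uallowed : TotalOrder.Carrier O) →
     APlus A → State X → TotalOrder.Carrier O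
UD O lem F ublocked uallowed a s =
  if ⌊ lem {G F s a} ⌋ then uallowed else ublocked

{-# OPTIONS --safe #-}
-- Because G(s) is never empty and U(·,s) takes the larger value exactly on
-- G(s), the optimal actions at s are precisely G(s); and G(s) determines F(s)
-- (as its part inside A) and is determined by it.  Hence Opt(s) = Opt(s')
-- iff F(s) = F(s'), and both sufficiency and relevance, which only ever
-- compare these sets at pairs of states, transfer in both directions.
module Submission where

open import Defs
open import Level using (Level; 0ℓ; _⊔_)
open import Data.Nat using (ℕ)
open import Data.Fin using (Fin)
open import Data.Fin.Subset using (Subset)
open import Data.Product using (Σ; _×_; _,_; proj₁; proj₂)
open import Data.Maybe using (just; nothing)
open import Data.Bool using (if_then_else_)
open import Function using (_∘_)
open import Function.Bundles using (_⇔_; mk⇔; Equivalence)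
open import Function.Construct.Symmetry using (⇔-sym)
open import Relation.Binary.Bundles using (TotalOrder)
open import Relation.Binary.PropositionalEquality using (_≡_; refl; subst; sym)
open import Relation.Nullary using (¬_; yes; no; Dec; contradiction; contraposition)
open import Relation.Nullary.Decidable using (⌊_⌋)
open import Axiom.ExcludedMiddle using (ExcludedMiddle)

open Equivalence using (to; from)

private
  variable
    p p′ q q′ : Level
    B : Set

-- SetEq at arbitrary levels: Opt takes values in Set ℓ₂.
_≐′_ : (B → Set p) → (B → Set q) → Set (p ⊔ q)
P ≐′ Q = ∀ b → (P b → Q b) × (Q b → P b)

≐′-respects-⇔ : {P : B → Set p} {P′ : B → Set p′} {Q : B → Set q} {Q′ : B → Set q′} →
                (∀ b → P b ⇔ P′ b) → (∀ b → Q b ⇔ Q′ b) → P ≐′ Q → P′ ≐′ Q′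
≐′-respects-⇔ P⇔P′ Q⇔Q′ P≐Q b =
    (λ p′ → to (Q⇔Q′ b) (proj₁ (P≐Q b) (from (P⇔P′ b) p′)))
  , (λ q′ → to (P⇔P′ b) (proj₂ (P≐Q b) (from (Q⇔Q′ b) q′)))

module _ {c ℓ₁ ℓ₂} (O : TotalOrder c ℓ₁ ℓ₂) where
  open TotalOrder O using (Carrier; _≤_; antisym) renaming (refl to ≤-refl)

  indicator : {P : B → Set p} → (∀ b → Dec (P b)) → Carrier → Carrier → B → Carrier
  indicator P? lo hi b = if ⌊ P? b ⌋ then hi else lo

  module _ {P : B → Set p} (P? : ∀ b → Dec (P b)) {lo hi : Carrier} (lo<hi : _<ᵤ_ O lo hi) where

    private
      u : B → Carrier
      u = indicator P? lo hi

    indicator-≤-hi : ∀ b → u b ≤ hi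
    indicator-≤-hi b with P? b
    ... | yes _ = ≤-refl
    ... | no  _ = proj₁ lo<hi

    indicator-∈ : ∀ {b} → P b → u b ≡ hi
    indicator-∈ {b} Pb with P? b
    ... | yes _  = refl
    ... | no ¬Pb = contradiction Pb ¬Pb

    -- Nonemptiness of P is needed: if P is empty, every b maximises u.
    indicator-maximal⇔ : Σ B P → ∀ b → (∀ b′ → u b′ ≤ u b) ⇔ P b
    indicator-maximal⇔ (w , Pw) b = mk⇔ maximal⇒P P⇒maximal
      where
      maximal⇒P : (∀ b′ → u b′ ≤ u b) → P b
      maximal⇒P uw≤ub with P? b
      ... | yes Pb = Pb
      ... | no _   = contradiction (antisym (proj₁ lo<hi) hi≤lo) (proj₂ lo<hi)
        where
        hi≤lo : hi ≤ lo
        hi≤lo = subst (_≤ lo) (indicator-∈ Pw) (uw≤ub w)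

      P⇒maximal : P b → ∀ b′ → u b′ ≤ u b
      P⇒maximal Pb b′ = subst (u b′ ≤_) (sym (indicator-∈ Pb)) (indicator-≤-hi b′)

module _ {n : ℕ} {X : Fin n → Set} {A : Set} (F : State X → A → Set) where

  G-nonempty : ExcludedMiddle 0ℓ → ∀ s → Σ (APlus A) (G F s)
  G-nonempty lem s with lem {Σ A (F s)}
  ... | yes (a , Fsa) = just a , Fsa
  ... | no  F-empty   = nothing , λ a Fsa → F-empty (a , Fsa)

  G-cong : ∀ {s s′} → SetEq (F s) (F s′) → G F s ≐′ G F s′
  G-cong Fs≐Fs′ (just a) = Fs≐Fs′ a
  G-cong Fs≐Fs′ nothing  =
      (λ Fs-empty a → contraposition (proj₂ (Fs≐Fs′ a)) (Fs-empty a))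
    , (λ Fs′-empty a → contraposition (proj₁ (Fs≐Fs′ a)) (Fs′-empty a))

  G-reflects : ∀ {s s′} → G F s ≐′ G F s′ → SetEq (F s) (F s′)
  G-reflects Gs≐Gs′ a = Gs≐Gs′ (just a)

module _ {c ℓ₁ ℓ₂} (O : TotalOrder c ℓ₁ ℓ₂) (lem : ExcludedMiddle 0ℓ)
         {n : ℕ} {X : Fin n → Set} {A : Set} (F : State X → A → Set)
         {ublocked uallowed : TotalOrder.Carrier O} (blocked<allowed : _<ᵤ_ O ublocked uallowed) where

  private
    U : APlus A → State X → TotalOrder.Carrier O
    U = UD O lem F ublocked uallowed

  Opt⇔G : ∀ s a → Opt O U s a ⇔ G F s a
  Opt⇔G s = indicator-maximal⇔ O (λ _ → lem) blocked<allowed (G-nonempty F lem s)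

  F-agree⇔Opt-agree : ∀ s s′ → SetEq (F s) (F s′) ⇔ (Opt O U s ≐′ Opt O U s′)
  F-agree⇔Opt-agree s s′ = mk⇔
    (λ Fs≐Fs′ → ≐′-respects-⇔ (⇔-sym ∘ Opt⇔G s) (⇔-sym ∘ Opt⇔G s′) (G-cong F Fs≐Fs′))
    (λ Opts≐Opts′ → G-reflects F (≐′-respects-⇔ (Opt⇔G s) (Opt⇔G s′) Opts≐Opts′))

mainTheorem12 : ∀ {c ℓ₁ ℓ₂} (O : TotalOrder c ℓ₁ ℓ₂) (lem : ExcludedMiddle 0ℓ)
    {n : ℕ} (X : Fin n → Set) (A : Set) (F : State X → A → Set)
    (ublocked uallowed : TotalOrder.Carrier O) → _<ᵤ_ O ublocked uallowed →
    ((I : Subset n) → SufficientMap F I ⇔ SufficientD O (UD O lem F ublocked uallowed) I)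
    × ((i : Fin n) → RelevantMap F i ⇔ RelevantD O (UD O lem F ublocked uallowed) i)
mainTheorem12 O lem X A F ublocked uallowed blocked<allowed =
    (λ I → mk⇔ (λ suff s s′ agree → to   (agree⇔ s s′) (suff s s′ agree))
               (λ suff s s′ agree → from (agree⇔ s s′) (suff s s′ agree)))
  , (λ i → mk⇔ (λ { (s , s′ , agree , differ) → s , s′ , agree , contraposition (from (agree⇔ s s′)) differ })
               (λ { (s , s′ , agree , differ) → s , s′ , agree , contraposition (to   (agree⇔ s s′)) differ }))
  where
  U : APlus A → State X → TotalOrder.Carrier O
  U = UD O lem F ublocked uallowed

  agree⇔ : ∀ s s′ → SetEq (F s) (F s′) ⇔ (Opt O U s ≐′ Opt O U s′)
  agree⇔ = F-agree⇔Opt-agree O lem F blocked<allowed
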